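{- (Normalization for $\mathbf{V}$.) Every term typable in $\mathbf{V}$ is normalizing: if $\Gamma\vdash_{\mathbf{V}} t: A$, then there is a finite reduction sequence $t\to_{\mathbf{V}}^* t'$ with $t'$ in $\to_{\mathbf{V}}$-normal form.
   Context: Formulas are built from propositional atoms and $\bot$ using $\to,\land,\lor$; $\neg B$ abbreviates $B\to\bot$. Terms of $\mathbf{V}$: $t,s,u ::= x \mid t\,s \mid \lambda x.t \mid \mathtt{efq}(t) \mid \langle t,s\rangle \mid \pi_i t \mid \mathtt{in}_i t \mid \mathtt{case}\ t\ [y.s_1]\ [y.s_2] \mid \mathtt{V}_n(\vec x.t,\ y.s_1,\ y.s_2,\ z.\vec u)$ ($i\in\{1,2\}$, $n\ge 1$), where in $\mathtt{V}_n$ the variables $\vec x=x_1,\dots,x_n$ are bound in $t$, $y$ is bound in $s_1,s_2$, $z$ is bound in each of $\vec u=u_1,\dots,u_n$; terms are up to $\alpha$-equivalence and $t\{x:=s\}$ is capture-avoiding substitution. Notation: $\lambda\vec x.t:=\lambda x_1.\cdots\lambda x_n.t$, and for formulas $(B_i\to C_i)_{i=1\dots n}\to E := (B_1\to C_1)\to(\cdots\to((B_n\to C_n)\to E))$. Typing $\Gamma\vdash t:A$ ($\Gamma$ a finite set of declarations $x:A$ with distinct variables) uses the standard natural-deduction rules of intuitionistic propositional logic ($\mathbf{IPC}$): axiom $\Gamma\vdash x:A$ for $(x:A)\in\Gamma$; $\lambda$-abstraction for $\to_I$; application for $\to_E$; pairs for $\land_I$; $\pi_i t:A_i$ from $t:A_1\land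 A_2$; $\mathtt{in}_i t: A_1\lor A_2$ from $t:A_i$; $\mathtt{case}\,t\,[y.s_1][y.s_2]:D$ from $\Gamma\vdash t:A_1\lor A_2$ and $\Gamma,y:A_i\vdash s_i:D$; $\mathtt{efq}(t):A$ from $t:\bot$; plus the rule Visser$_n$: from $x_1:B_1\to C_1,\dots,x_n:B_n\to C_n\vdash t:A_1\lor A_2$ (with exactly these assumptions), $\Gamma,y:(B_i\to C_i)_{i=1\dots n}\to A_1\vdash s_1:D$, $\Gamma,y:(B_i\to C_i)_{i=1\dots n}\to A_2\vdash s_2:D$, and $\Gamma,z:(B_i\to C_i)_{i=1\dots n}\to B_j\vdash u_j:D$ for each $j=1,\dots,n$, infer $\Gamma\vdash \mathtt{V}_n(\vec x.t,y.s_1,y.s_2,z.\vec u):D$. $\vdash_{\mathbf{V}}$ denotes derivability with all these rules. Weak head contexts: $W::=\Box\mid W\,t\mid \pi_i W\mid \mathtt{case}\ W\ [y.s_1]\ [y.s_2]$, and $W\langle t\rangle$ is $W$ with its hole replaced by $t$. Top-level reductions: $(\lambda x.t)s\mapsto t\{x:=s\}$; $\pi_i\langle t_1,t_2\rangle\mapsto t_i$; $\mathtt{case}\,(\mathtt{in}_i t)\,[y.s_1][y.s_2]\mapsto s_i\{y:=t\}$; $\mathtt{V}_n(\vec x.\mathtt{in}_i t, y.s_1,y.s_2,z.\vec u)\mapsto s_i\{y:=\lambda\vec x.t\}$ ($i=1,2$); $\mathtt{V}_n(\vec x.W\langle\mathtt{efq}(t)\rangle, y.s_1,y.s_2,z.\vec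 u)\mapsto s_1\{y:=\lambda\vec x.\mathtt{efq}(t)\}$; $\mathtt{V}_n(\vec x.W\langle x_j\,t\rangle, y.s_1,y.s_2,z.\vec u)\mapsto u_j\{z:=\lambda\vec x.t\}$ ($j=1,\dots,n$). $\to_{\mathbf{V}}$ is the closure of these top-level reductions under all term constructors. -}

module Defs where

open import Data.Nat using (ℕ; zero; suc; _+_)
open import Data.Fin using (Fin; zero; suc; _↑ˡ_)
open import Data.Vec using (Vec; []; _∷_; lookup; zipWith)
open import Data.Vec.Functional using (Vector; updateAt)
open import Data.Product using (∃; ∃-syntax; _×_; _,_)
open import Relation.Nullary using (¬_)
open import Relation.Binary.PropositionalEquality using (_≡_)
open import Relation.Binary.Construct.Closure.ReflexiveTransitive using (Star)

data Form : Set where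
  atom : ℕ → Form
  ⊥'   : Form
  _⇒_  : Form → Form → Form
  _∧'_ : Form → Form → Form
  _∨'_ : Form → Form → Form

infixr 5 _⇒_

-- arrows (A₀ ∷ A₁ ∷ … ∷ Aₙ₋₁) E  =  Aₙ₋₁ ⇒ ⋯ ⇒ A₁ ⇒ A₀ ⇒ E
-- (the de Bruijn variable 0 is the innermost bound one, matching `lams`)
arrows : ∀ {n} → Vec Form n → Form → Form
arrows []       E = E
arrows (A ∷ As) E = arrows As (A ⇒ E)

data Tm (m : ℕ) : Set where
  var   : Fin m → Tm m
  app   : Tm m → Tm m → Tm m
  lam   : Tm (suc m) → Tm m
  efq   : Tm m → Tm m
  pair  : Tm m → Tm m → Tm m
  π₁ π₂ : Tm m → Tm m
  in₁ in₂ : Tm m → Tm m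
  case  : Tm m → Tm (suc m) → Tm (suc m) → Tm m
  -- V (suc k) : binds n = suc k variables x⃗ in t, y in s₁ s₂, z in each u_j
  V     : (k : ℕ) → Tm (suc k + m) → Tm (suc m) → Tm (suc m)
        → Vector (Tm (suc m)) (suc k) → Tm m

-- λx⃗.t  (innermost binder = de Bruijn index 0)
lams : ∀ {m} (n : ℕ) → Tm (n + m) → Tm m
lams zero    t = t
lams (suc n) t = lams n (lam t)

Ren : ℕ → ℕ → Set
Ren m n = Fin m → Fin n

liftR : ∀ {m n} → Ren m n → Ren (suc m) (suc n)
liftR ρ zero    = zero
liftR ρ (suc i) = suc (ρ i)

liftRⁿ : ∀ {m n} (k : ℕ) → Ren m n → Ren (k + m) (k + n)
liftRⁿ zero    ρ = ρ
liftRⁿ (suc k) ρ = liftR (liftRⁿ k ρ)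

ren : ∀ {m n} → Ren m n → Tm m → Tm n
ren ρ (var i)        = var (ρ i)
ren ρ (app t s)      = app (ren ρ t) (ren ρ s)
ren ρ (lam t)        = lam (ren (liftR ρ) t)
ren ρ (efq t)        = efq (ren ρ t)
ren ρ (pair t s)     = pair (ren ρ t) (ren ρ s)
ren ρ (π₁ t)         = π₁ (ren ρ t)
ren ρ (π₂ t)         = π₂ (ren ρ t)
ren ρ (in₁ t)        = in₁ (ren ρ t)
ren ρ (in₂ t)        = in₂ (ren ρ t)
ren ρ (case t s₁ s₂) = case (ren ρ t) (ren (liftR ρ) s₁) (ren (liftR ρ) s₂)
ren ρ (V k t s₁ s₂ us) =
  V k (ren (liftRⁿ (suc k) ρ) t) (ren (liftR ρ) s₁) (ren (liftR ρ) s₂)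
      (λ j → ren (liftR ρ) (us j))

Sub : ℕ → ℕ → Set
Sub m n = Fin m → Tm n

liftS : ∀ {m n} → Sub m n → Sub (suc m) (suc n)
liftS σ zero    = var zero
liftS σ (suc i) = ren suc (σ i)

liftSⁿ : ∀ {m n} (k : ℕ) → Sub m n → Sub (k + m) (k + n)
liftSⁿ zero    σ = σ
liftSⁿ (suc k) σ = liftS (liftSⁿ k σ)

sub : ∀ {m n} → Sub m n → Tm m → Tm n
sub σ (var i)        = σ i
sub σ (app t s)      = app (sub σ t) (sub σ s)
sub σ (lam t)        = lam (sub (liftS σ) t)
sub σ (efq t)        = efq (sub σ t)
sub σ (pair t s)     = pair (sub σ t) (sub σ s)
sub σ (π₁ t)         = π₁ (sub σ t)
sub σ (π₂ t)         = π₂ (sub σ t)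
sub σ (in₁ t)        = in₁ (sub σ t)
sub σ (in₂ t)        = in₂ (sub σ t)
sub σ (case t s₁ s₂) = case (sub σ t) (sub (liftS σ) s₁) (sub (liftS σ) s₂)
sub σ (V k t s₁ s₂ us) =
  V k (sub (liftSⁿ (suc k) σ) t) (sub (liftS σ) s₁) (sub (liftS σ) s₂)
      (λ j → sub (liftS σ) (us j))

single : ∀ {m} → Tm m → Sub (suc m) m
single s zero    = s
single s (suc i) = var i

_[_] : ∀ {m} → Tm (suc m) → Tm m → Tm m
t [ s ] = sub (single s) t

data WCtx (m : ℕ) : Set where
  hole  : WCtx m
  appW  : WCtx m → Tm m → WCtx m
  π₁W   : WCtx m → WCtx m
  π₂W   : WCtx m → WCtx m
  caseW : WCtx m → Tm (suc m) → Tm (suc m) → WCtx m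

plug : ∀ {m} → WCtx m → Tm m → Tm m
plug hole            h = h
plug (appW W s)      h = app (plug W h) s
plug (π₁W W)         h = π₁ (plug W h)
plug (π₂W W)         h = π₂ (plug W h)
plug (caseW W s₁ s₂) h = case (plug W h) s₁ s₂

infix 4 _⟶_
data _⟶_ {m : ℕ} : Tm m → Tm m → Set where
  β      : ∀ {t s} → app (lam t) s ⟶ t [ s ]
  π₁β    : ∀ {t s} → π₁ (pair t s) ⟶ t
  π₂β    : ∀ {t s} → π₂ (pair t s) ⟶ s
  case₁β : ∀ {t s₁ s₂} → case (in₁ t) s₁ s₂ ⟶ s₁ [ t ]
  case₂β : ∀ {t s₁ s₂} → case (in₂ t) s₁ s₂ ⟶ s₂ [ t ]
  V-in₁  : ∀ {k t s₁ s₂ us} →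
           V k (in₁ t) s₁ s₂ us ⟶ s₁ [ lams (suc k) t ]
  V-in₂  : ∀ {k t s₁ s₂ us} →
           V k (in₂ t) s₁ s₂ us ⟶ s₂ [ lams (suc k) t ]
  V-efq  : ∀ {k} (W : WCtx (suc k + m)) {t s₁ s₂ us} →
           V k (plug W (efq t)) s₁ s₂ us ⟶ s₁ [ lams (suc k) (efq t) ]
  V-var  : ∀ {k} (W : WCtx (suc k + m)) (j : Fin (suc k)) {t s₁ s₂ us} →
           V k (plug W (app (var (j ↑ˡ m)) t)) s₁ s₂ us
             ⟶ us j [ lams (suc k) t ]
  appˡ   : ∀ {t t' s} → t ⟶ t' → app t s ⟶ app t' s
  appʳ   : ∀ {t s s'} → s ⟶ s' → app t s ⟶ app t s'
  lamᶜ   : ∀ {t t'} → t ⟶ t' → lam t ⟶ lam t'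
  efqᶜ   : ∀ {t t'} → t ⟶ t' → efq t ⟶ efq t'
  pairˡ  : ∀ {t t' s} → t ⟶ t' → pair t s ⟶ pair t' s
  pairʳ  : ∀ {t s s'} → s ⟶ s' → pair t s ⟶ pair t s'
  π₁ᶜ    : ∀ {t t'} → t ⟶ t' → π₁ t ⟶ π₁ t'
  π₂ᶜ    : ∀ {t t'} → t ⟶ t' → π₂ t ⟶ π₂ t'
  in₁ᶜ   : ∀ {t t'} → t ⟶ t' → in₁ t ⟶ in₁ t'
  in₂ᶜ   : ∀ {t t'} → t ⟶ t' → in₂ t ⟶ in₂ t'
  caseᶜ  : ∀ {t t' s₁ s₂} → t ⟶ t' → case t s₁ s₂ ⟶ case t' s₁ s₂
  case₁ᶜ : ∀ {t s₁ s₁' s₂} → s₁ ⟶ s₁' → case t s₁ s₂ ⟶ case t s₁' s₂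
  case₂ᶜ : ∀ {t s₁ s₂ s₂'} → s₂ ⟶ s₂' → case t s₁ s₂ ⟶ case t s₁ s₂'
  Vᶜ     : ∀ {k t t' s₁ s₂ us} → t ⟶ t' →
           V k t s₁ s₂ us ⟶ V k t' s₁ s₂ us
  V₁ᶜ    : ∀ {k t s₁ s₁' s₂ us} → s₁ ⟶ s₁' →
           V k t s₁ s₂ us ⟶ V k t s₁' s₂ us
  V₂ᶜ    : ∀ {k t s₁ s₂ s₂' us} → s₂ ⟶ s₂' →
           V k t s₁ s₂ us ⟶ V k t s₁ s₂' us
  Vuᶜ    : ∀ {k t s₁ s₂ us u'} (j : Fin (suc k)) → us j ⟶ u' →
           V k t s₁ s₂ us ⟶ V k t s₁ s₂ (updateAt us j (λ _ → u'))

infix 4 _⟶*_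
_⟶*_ : ∀ {m} → Tm m → Tm m → Set
_⟶*_ = Star _⟶_

Normal : ∀ {m} → Tm m → Set
Normal t = ¬ (∃[ t' ] (t ⟶ t'))

Ctx : ℕ → Set
Ctx m = Vec Form m

wkBound : ∀ {n} m → Ren n (n + m)
wkBound m i = i ↑ˡ m

infix 3 _⊢_∶_
data _⊢_∶_ {m : ℕ} (Γ : Ctx m) : Tm m → Form → Set where
  ax    : ∀ i → Γ ⊢ var i ∶ lookup Γ i
  ⇒I    : ∀ {A B t} → (A ∷ Γ) ⊢ t ∶ B → Γ ⊢ lam t ∶ A ⇒ B
  ⇒E    : ∀ {A B t s} → Γ ⊢ t ∶ A ⇒ B → Γ ⊢ s ∶ A → Γ ⊢ app t s ∶ B
  ∧I    : ∀ {A B t s} → Γ ⊢ t ∶ A → Γ ⊢ s ∶ B → Γ ⊢ pair t s ∶ A ∧' B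
  ∧E₁   : ∀ {A B t} → Γ ⊢ t ∶ A ∧' B → Γ ⊢ π₁ t ∶ A
  ∧E₂   : ∀ {A B t} → Γ ⊢ t ∶ A ∧' B → Γ ⊢ π₂ t ∶ B
  ∨I₁   : ∀ {A B t} → Γ ⊢ t ∶ A → Γ ⊢ in₁ t ∶ A ∨' B
  ∨I₂   : ∀ {A B t} → Γ ⊢ t ∶ B → Γ ⊢ in₂ t ∶ A ∨' B
  ∨E    : ∀ {A B D t s₁ s₂} → Γ ⊢ t ∶ A ∨' B →
          (A ∷ Γ) ⊢ s₁ ∶ D → (B ∷ Γ) ⊢ s₂ ∶ D → Γ ⊢ case t s₁ s₂ ∶ D
  ⊥E    : ∀ {A t} → Γ ⊢ t ∶ ⊥' → Γ ⊢ efq t ∶ A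
  -- Visser_n with n = suc k; Bs, Cs list B_i, C_i (index 0 = innermost x).
  -- The body t must be typed with exactly the assumptions x⃗ : B⃗ → C⃗,
  -- so it is (the weakening of) a term t₀ in scope n only.
  visser : ∀ {k} (Bs Cs : Vec Form (suc k)) {A₁ A₂ D}
           {t : Tm (suc k + m)} {s₁ s₂ : Tm (suc m)}
           {us : Vector (Tm (suc m)) (suc k)} (t₀ : Tm (suc k)) →
           t ≡ ren (wkBound m) t₀ →
           zipWith _⇒_ Bs Cs ⊢ t₀ ∶ A₁ ∨' A₂ →
           (arrows (zipWith _⇒_ Bs Cs) A₁ ∷ Γ) ⊢ s₁ ∶ D →
           (arrows (zipWith _⇒_ Bs Cs) A₂ ∷ Γ) ⊢ s₂ ∶ D →
           (∀ j → (arrows (zipWith _⇒_ Bs Cs) (lookup Bs j) ∷ Γ) ⊢ us j ∶ D) →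
           Γ ⊢ V k t s₁ s₂ us ∶ D

module Submission where

-- The proof is Tait–Girard reducibility in Kripke style.  A term t : A in a
-- context Γ is reducible when it reduces to a normal form that is again
-- typable at A, and, by recursion on A, it behaves reducibly under
-- elimination: after any renaming into a larger context it maps reducible
-- arguments to reducible results (⇒), its projections are reducible (∧), and
-- it reduces to an injection of a reducible term or to a typed neutral term
-- (∨).  Reducibility is closed under ≈, head expansion, renaming, and contains
-- the typed neutral terms.  The fundamental lemma (every typed term is
-- reducible under every reducible substitution) then gives the theorem by
-- taking the identity substitution.
--
-- The new case is the Visser rule.  Its body t₀ lives in a context Θ = x⃗ : B⃗ → C⃗
-- of implications only; t₀ normalizes to a typed normal form w, and such a w
-- of type A₁ ∨ A₂ is an injection or a neutral term stuck at W⟨efq x⟩ or at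
-- W⟨xⱼ x⟩ (lemma `decompose`).  In each case one of the top-level V rules fires,
-- and the contractum is reducible by the hypotheses for s₁, s₂, u⃗ since the
-- abstraction λx⃗.b of a V-free typed term b is reducible (fundamental lemma
-- for V-free derivations, proved first).
--
-- The branch vector u⃗ of V is a function, so terms are compared with the
-- pointwise equality _≈_ (there is no function extensionality); on V-free
-- terms, and hence on normal forms, it coincides with _≡_.

open import Defs
open import Data.Nat using (ℕ; zero; suc; _+_)
open import Data.Fin using (Fin; zero; suc; _↑ˡ_)
open import Data.Vec using (Vec; []; _∷_; lookup; zipWith; _++_)
open import Data.Vec.Properties using (lookup-++ˡ; lookup-zipWith)
open import Data.Vec.Functional using (Vector; updateAt; tail)
open import Data.Product using (Σ; ∃-syntax; _×_; _,_; proj₁; proj₂)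
open import Data.Sum using (_⊎_; inj₁; inj₂)
open import Data.Unit using (⊤; tt)
open import Data.Empty using (⊥)
open import Relation.Nullary using (¬_)
open import Relation.Binary.PropositionalEquality
  using (_≡_; refl; sym; trans; cong; cong₂; subst)
open import Relation.Binary.Construct.Closure.ReflexiveTransitive
  using (ε; _◅_; _◅◅_; gmap)

infix 4 _≈_
data _≈_ {m : ℕ} : Tm m → Tm m → Set where
  var≈  : ∀ {i} → var i ≈ var i
  app≈  : ∀ {a a' b b'} → a ≈ a' → b ≈ b' → app a b ≈ app a' b'
  lam≈  : ∀ {a a'} → a ≈ a' → lam a ≈ lam a'
  efq≈  : ∀ {a a'} → a ≈ a' → efq a ≈ efq a'
  pair≈ : ∀ {a a' b b'} → a ≈ a' → b ≈ b' → pair a b ≈ pair a' b'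
  π₁≈   : ∀ {a a'} → a ≈ a' → π₁ a ≈ π₁ a'
  π₂≈   : ∀ {a a'} → a ≈ a' → π₂ a ≈ π₂ a'
  in₁≈  : ∀ {a a'} → a ≈ a' → in₁ a ≈ in₁ a'
  in₂≈  : ∀ {a a'} → a ≈ a' → in₂ a ≈ in₂ a'
  case≈ : ∀ {a a' b b' c c'} → a ≈ a' → b ≈ b' → c ≈ c' →
          case a b c ≈ case a' b' c'
  V≈    : ∀ {k a a' b b' c c' us us'} → a ≈ a' → b ≈ b' → c ≈ c' →
          (∀ j → us j ≈ us' j) → V k a b c us ≈ V k a' b' c' us'

≈-refl : ∀ {m} {t : Tm m} → t ≈ t
≈-refl {t = var _}        = var≈
≈-refl {t = app _ _}      = app≈ ≈-refl ≈-refl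
≈-refl {t = lam _}        = lam≈ ≈-refl
≈-refl {t = efq _}        = efq≈ ≈-refl
≈-refl {t = pair _ _}     = pair≈ ≈-refl ≈-refl
≈-refl {t = π₁ _}         = π₁≈ ≈-refl
≈-refl {t = π₂ _}         = π₂≈ ≈-refl
≈-refl {t = in₁ _}        = in₁≈ ≈-refl
≈-refl {t = in₂ _}        = in₂≈ ≈-refl
≈-refl {t = case _ _ _}   = case≈ ≈-refl ≈-refl ≈-refl
≈-refl {t = V _ _ _ _ _}  = V≈ ≈-refl ≈-refl ≈-refl (λ _ → ≈-refl)

≈-sym : ∀ {m} {t u : Tm m} → t ≈ u → u ≈ t
≈-sym var≈          = var≈
≈-sym (app≈ p q)    = app≈ (≈-sym p) (≈-sym q)
≈-sym (lam≈ p)      = lam≈ (≈-sym p)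
≈-sym (efq≈ p)      = efq≈ (≈-sym p)
≈-sym (pair≈ p q)   = pair≈ (≈-sym p) (≈-sym q)
≈-sym (π₁≈ p)       = π₁≈ (≈-sym p)
≈-sym (π₂≈ p)       = π₂≈ (≈-sym p)
≈-sym (in₁≈ p)      = in₁≈ (≈-sym p)
≈-sym (in₂≈ p)      = in₂≈ (≈-sym p)
≈-sym (case≈ p q r) = case≈ (≈-sym p) (≈-sym q) (≈-sym r)
≈-sym (V≈ p q r f)  = V≈ (≈-sym p) (≈-sym q) (≈-sym r) (λ j → ≈-sym (f j))

≈-trans : ∀ {m} {t u v : Tm m} → t ≈ u → u ≈ v → t ≈ v
≈-trans var≈          var≈             = var≈
≈-trans (app≈ p q)    (app≈ p' q')     = app≈ (≈-trans p p') (≈-trans q q')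
≈-trans (lam≈ p)      (lam≈ p')        = lam≈ (≈-trans p p')
≈-trans (efq≈ p)      (efq≈ p')        = efq≈ (≈-trans p p')
≈-trans (pair≈ p q)   (pair≈ p' q')    = pair≈ (≈-trans p p') (≈-trans q q')
≈-trans (π₁≈ p)       (π₁≈ p')         = π₁≈ (≈-trans p p')
≈-trans (π₂≈ p)       (π₂≈ p')         = π₂≈ (≈-trans p p')
≈-trans (in₁≈ p)      (in₁≈ p')        = in₁≈ (≈-trans p p')
≈-trans (in₂≈ p)      (in₂≈ p')        = in₂≈ (≈-trans p p')
≈-trans (case≈ p q r) (case≈ p' q' r') =
  case≈ (≈-trans p p') (≈-trans q q') (≈-trans r r')
≈-trans (V≈ p q r f)  (V≈ p' q' r' f') =
  V≈ (≈-trans p p') (≈-trans q q') (≈-trans r r') (λ j → ≈-trans (f j) (f' j))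

≡⇒≈ : ∀ {m} {t u : Tm m} → t ≡ u → t ≈ u
≡⇒≈ refl = ≈-refl

-- V-free terms.  On them ≈ is just ≡, so reductions ending in a V-free term
-- (e.g. a normal form) can be transported exactly along ≈.

VFree : ∀ {m} → Tm m → Set
VFree (var _)        = ⊤
VFree (app t s)      = VFree t × VFree s
VFree (lam t)        = VFree t
VFree (efq t)        = VFree t
VFree (pair t s)     = VFree t × VFree s
VFree (π₁ t)         = VFree t
VFree (π₂ t)         = VFree t
VFree (in₁ t)        = VFree t
VFree (in₂ t)        = VFree t
VFree (case t s₁ s₂) = VFree t × VFree s₁ × VFree s₂
VFree (V _ _ _ _ _)  = ⊥

VFree-≈⇒≡ : ∀ {m} {a b : Tm m} → a ≈ b → VFree a → a ≡ b
VFree-≈⇒≡ var≈          _         = refl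
VFree-≈⇒≡ (app≈ p q)    (v , w)   = cong₂ app (VFree-≈⇒≡ p v) (VFree-≈⇒≡ q w)
VFree-≈⇒≡ (lam≈ p)      v         = cong lam (VFree-≈⇒≡ p v)
VFree-≈⇒≡ (efq≈ p)      v         = cong efq (VFree-≈⇒≡ p v)
VFree-≈⇒≡ (pair≈ p q)   (v , w)   = cong₂ pair (VFree-≈⇒≡ p v) (VFree-≈⇒≡ q w)
VFree-≈⇒≡ (π₁≈ p)       v         = cong π₁ (VFree-≈⇒≡ p v)
VFree-≈⇒≡ (π₂≈ p)       v         = cong π₂ (VFree-≈⇒≡ p v)
VFree-≈⇒≡ (in₁≈ p)      v         = cong in₁ (VFree-≈⇒≡ p v)
VFree-≈⇒≡ (in₂≈ p)      v         = cong in₂ (VFree-≈⇒≡ p v)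
VFree-≈⇒≡ (case≈ p q r) (u , v , w)
  with refl ← VFree-≈⇒≡ p u | refl ← VFree-≈⇒≡ q v | refl ← VFree-≈⇒≡ r w = refl

VFree-ren : ∀ {m n} (ρ : Ren m n) (t : Tm m) → VFree t → VFree (ren ρ t)
VFree-ren ρ (var _)        _           = tt
VFree-ren ρ (app t s)      (v , w)     = VFree-ren ρ t v , VFree-ren ρ s w
VFree-ren ρ (lam t)        v           = VFree-ren (liftR ρ) t v
VFree-ren ρ (efq t)        v           = VFree-ren ρ t v
VFree-ren ρ (pair t s)     (v , w)     = VFree-ren ρ t v , VFree-ren ρ s w
VFree-ren ρ (π₁ t)         v           = VFree-ren ρ t v
VFree-ren ρ (π₂ t)         v           = VFree-ren ρ t v
VFree-ren ρ (in₁ t)        v           = VFree-ren ρ t v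
VFree-ren ρ (in₂ t)        v           = VFree-ren ρ t v
VFree-ren ρ (case t s₁ s₂) (u , v , w) =
  VFree-ren ρ t u , VFree-ren (liftR ρ) s₁ v , VFree-ren (liftR ρ) s₂ w

VFree-lams : ∀ {m} n (t : Tm (n + m)) → VFree t → VFree (lams n t)
VFree-lams zero    t v = v
VFree-lams (suc n) t v = VFree-lams n (lam t) v

-- Each law is proved by one traversal,
-- generalised over a pointwise hypothesis on the (renaming or substitution)
-- maps so that it survives going under binders (the lift lemmas).

RenEq : ∀ {m n} → Ren m n → Ren m n → Set
RenEq ρ ρ' = ∀ i → ρ i ≡ ρ' i

liftR-≡ : ∀ {m n} {ρ ρ' : Ren m n} → RenEq ρ ρ' → RenEq (liftR ρ) (liftR ρ')
liftR-≡ h zero = refl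
liftR-≡ h (suc i) = cong suc (h i)

liftRⁿ-≡ : ∀ {m n} k {ρ ρ' : Ren m n} → RenEq ρ ρ' → RenEq (liftRⁿ k ρ) (liftRⁿ k ρ')
liftRⁿ-≡ zero h = h
liftRⁿ-≡ (suc k) h = liftR-≡ (liftRⁿ-≡ k h)

ren-cong : ∀ {m n} {ρ ρ' : Ren m n} {t t' : Tm m} → RenEq ρ ρ' → t ≈ t' → ren ρ t ≈ ren ρ' t'
ren-cong h (var≈ {i}) = ≡⇒≈ (cong var (h i))
ren-cong h (app≈ p q) = app≈ (ren-cong h p) (ren-cong h q)
ren-cong h (lam≈ p) = lam≈ (ren-cong (liftR-≡ h) p)
ren-cong h (efq≈ p) = efq≈ (ren-cong h p)
ren-cong h (pair≈ p q) = pair≈ (ren-cong h p) (ren-cong h q)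
ren-cong h (π₁≈ p) = π₁≈ (ren-cong h p)
ren-cong h (π₂≈ p) = π₂≈ (ren-cong h p)
ren-cong h (in₁≈ p) = in₁≈ (ren-cong h p)
ren-cong h (in₂≈ p) = in₂≈ (ren-cong h p)
ren-cong h (case≈ p q r) = case≈ (ren-cong h p) (ren-cong (liftR-≡ h) q) (ren-cong (liftR-≡ h) r)
ren-cong h (V≈ {k} p q r f) =
  V≈ (ren-cong (liftRⁿ-≡ (suc k) h) p) (ren-cong (liftR-≡ h) q)
     (ren-cong (liftR-≡ h) r) (λ j → ren-cong (liftR-≡ h) (f j))

RenComp : ∀ {a b c} → Ren b c → Ren a b → Ren a c → Set
RenComp ρ ρ' ρ'' = ∀ i → ρ (ρ' i) ≡ ρ'' i

liftR-∘ : ∀ {a b c} {ρ : Ren b c} {ρ' : Ren a b} {ρ''} → RenComp ρ ρ' ρ'' →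
          RenComp (liftR ρ) (liftR ρ') (liftR ρ'')
liftR-∘ h zero = refl
liftR-∘ h (suc i) = cong suc (h i)

liftRⁿ-∘ : ∀ {a b c} k {ρ : Ren b c} {ρ' : Ren a b} {ρ''} → RenComp ρ ρ' ρ'' →
           RenComp (liftRⁿ k ρ) (liftRⁿ k ρ') (liftRⁿ k ρ'')
liftRⁿ-∘ zero h = h
liftRⁿ-∘ (suc k) h = liftR-∘ (liftRⁿ-∘ k h)

ren-ren : ∀ {a b c} {ρ : Ren b c} {ρ' : Ren a b} {ρ''} → RenComp ρ ρ' ρ'' → ∀ t →
          ren ρ (ren ρ' t) ≈ ren ρ'' t
ren-ren h (var x) = ≡⇒≈ (cong var (h x))
ren-ren h (app t s) = app≈ (ren-ren h t) (ren-ren h s)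
ren-ren h (lam t) = lam≈ (ren-ren (liftR-∘ h) t)
ren-ren h (efq t) = efq≈ (ren-ren h t)
ren-ren h (pair t s) = pair≈ (ren-ren h t) (ren-ren h s)
ren-ren h (π₁ t) = π₁≈ (ren-ren h t)
ren-ren h (π₂ t) = π₂≈ (ren-ren h t)
ren-ren h (in₁ t) = in₁≈ (ren-ren h t)
ren-ren h (in₂ t) = in₂≈ (ren-ren h t)
ren-ren h (case t s₁ s₂) = case≈ (ren-ren h t) (ren-ren (liftR-∘ h) s₁) (ren-ren (liftR-∘ h) s₂)
ren-ren h (V k t s₁ s₂ us) =
  V≈ (ren-ren (liftRⁿ-∘ (suc k) h) t) (ren-ren (liftR-∘ h) s₁)
     (ren-ren (liftR-∘ h) s₂) (λ j → ren-ren (liftR-∘ h) (us j))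

SubEq : ∀ {m n} → Sub m n → Sub m n → Set
SubEq σ σ' = ∀ i → σ i ≈ σ' i

liftS-≈ : ∀ {m n} {σ σ' : Sub m n} → SubEq σ σ' → SubEq (liftS σ) (liftS σ')
liftS-≈ h zero = var≈
liftS-≈ h (suc i) = ren-cong (λ _ → refl) (h i)

liftSⁿ-≈ : ∀ {m n} k {σ σ' : Sub m n} → SubEq σ σ' → SubEq (liftSⁿ k σ) (liftSⁿ k σ')
liftSⁿ-≈ zero h = h
liftSⁿ-≈ (suc k) h = liftS-≈ (liftSⁿ-≈ k h)

sub-cong : ∀ {m n} {σ σ' : Sub m n} {t t' : Tm m} → SubEq σ σ' → t ≈ t' → sub σ t ≈ sub σ' t'
sub-cong h (var≈ {i}) = h i
sub-cong h (app≈ p q) = app≈ (sub-cong h p) (sub-cong h q)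
sub-cong h (lam≈ p) = lam≈ (sub-cong (liftS-≈ h) p)
sub-cong h (efq≈ p) = efq≈ (sub-cong h p)
sub-cong h (pair≈ p q) = pair≈ (sub-cong h p) (sub-cong h q)
sub-cong h (π₁≈ p) = π₁≈ (sub-cong h p)
sub-cong h (π₂≈ p) = π₂≈ (sub-cong h p)
sub-cong h (in₁≈ p) = in₁≈ (sub-cong h p)
sub-cong h (in₂≈ p) = in₂≈ (sub-cong h p)
sub-cong h (case≈ p q r) = case≈ (sub-cong h p) (sub-cong (liftS-≈ h) q) (sub-cong (liftS-≈ h) r)
sub-cong h (V≈ {k} p q r f) =
  V≈ (sub-cong (liftSⁿ-≈ (suc k) h) p) (sub-cong (liftS-≈ h) q)
     (sub-cong (liftS-≈ h) r) (λ j → sub-cong (liftS-≈ h) (f j))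

RSComp : ∀ {a b c} → Ren b c → Sub a b → Sub a c → Set
RSComp ρ σ σ' = ∀ i → ren ρ (σ i) ≈ σ' i

liftRS-∘ : ∀ {a b c} {ρ : Ren b c} {σ : Sub a b} {σ'} → RSComp ρ σ σ' →
           RSComp (liftR ρ) (liftS σ) (liftS σ')
liftRS-∘ h zero = var≈
liftRS-∘ {ρ = ρ} {σ} h (suc i) =
  ≈-trans (ren-ren (λ _ → refl) (σ i))
    (≈-trans (≈-sym (ren-ren {ρ = suc} {ρ' = ρ} (λ _ → refl) (σ i))) (ren-cong (λ _ → refl) (h i)))

liftRSⁿ-∘ : ∀ {a b c} k {ρ : Ren b c} {σ : Sub a b} {σ'} → RSComp ρ σ σ' →
            RSComp (liftRⁿ k ρ) (liftSⁿ k σ) (liftSⁿ k σ')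
liftRSⁿ-∘ zero h = h
liftRSⁿ-∘ (suc k) h = liftRS-∘ (liftRSⁿ-∘ k h)

ren-sub : ∀ {a b c} {ρ : Ren b c} {σ : Sub a b} {σ'} → RSComp ρ σ σ' → ∀ t →
          ren ρ (sub σ t) ≈ sub σ' t
ren-sub h (var x) = h x
ren-sub h (app t s) = app≈ (ren-sub h t) (ren-sub h s)
ren-sub h (lam t) = lam≈ (ren-sub (liftRS-∘ h) t)
ren-sub h (efq t) = efq≈ (ren-sub h t)
ren-sub h (pair t s) = pair≈ (ren-sub h t) (ren-sub h s)
ren-sub h (π₁ t) = π₁≈ (ren-sub h t)
ren-sub h (π₂ t) = π₂≈ (ren-sub h t)
ren-sub h (in₁ t) = in₁≈ (ren-sub h t)
ren-sub h (in₂ t) = in₂≈ (ren-sub h t)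
ren-sub h (case t s₁ s₂) = case≈ (ren-sub h t) (ren-sub (liftRS-∘ h) s₁) (ren-sub (liftRS-∘ h) s₂)
ren-sub h (V k t s₁ s₂ us) =
  V≈ (ren-sub (liftRSⁿ-∘ (suc k) h) t) (ren-sub (liftRS-∘ h) s₁)
     (ren-sub (liftRS-∘ h) s₂) (λ j → ren-sub (liftRS-∘ h) (us j))

SRComp : ∀ {a b c} → Sub b c → Ren a b → Sub a c → Set
SRComp σ ρ σ' = ∀ i → σ (ρ i) ≈ σ' i

liftSR-∘ : ∀ {a b c} {σ : Sub b c} {ρ : Ren a b} {σ'} → SRComp σ ρ σ' →
           SRComp (liftS σ) (liftR ρ) (liftS σ')
liftSR-∘ h zero = var≈
liftSR-∘ h (suc i) = ren-cong (λ _ → refl) (h i)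

liftSRⁿ-∘ : ∀ {a b c} k {σ : Sub b c} {ρ : Ren a b} {σ'} → SRComp σ ρ σ' →
            SRComp (liftSⁿ k σ) (liftRⁿ k ρ) (liftSⁿ k σ')
liftSRⁿ-∘ zero h = h
liftSRⁿ-∘ (suc k) h = liftSR-∘ (liftSRⁿ-∘ k h)

sub-ren : ∀ {a b c} {σ : Sub b c} {ρ : Ren a b} {σ'} → SRComp σ ρ σ' → ∀ t →
          sub σ (ren ρ t) ≈ sub σ' t
sub-ren h (var x) = h x
sub-ren h (app t s) = app≈ (sub-ren h t) (sub-ren h s)
sub-ren h (lam t) = lam≈ (sub-ren (liftSR-∘ h) t)
sub-ren h (efq t) = efq≈ (sub-ren h t)
sub-ren h (pair t s) = pair≈ (sub-ren h t) (sub-ren h s)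
sub-ren h (π₁ t) = π₁≈ (sub-ren h t)
sub-ren h (π₂ t) = π₂≈ (sub-ren h t)
sub-ren h (in₁ t) = in₁≈ (sub-ren h t)
sub-ren h (in₂ t) = in₂≈ (sub-ren h t)
sub-ren h (case t s₁ s₂) = case≈ (sub-ren h t) (sub-ren (liftSR-∘ h) s₁) (sub-ren (liftSR-∘ h) s₂)
sub-ren h (V k t s₁ s₂ us) =
  V≈ (sub-ren (liftSRⁿ-∘ (suc k) h) t) (sub-ren (liftSR-∘ h) s₁)
     (sub-ren (liftSR-∘ h) s₂) (λ j → sub-ren (liftSR-∘ h) (us j))

SSComp : ∀ {a b c} → Sub b c → Sub a b → Sub a c → Set
SSComp σ τ σ' = ∀ i → sub σ (τ i) ≈ σ' i

liftSS-∘ : ∀ {a b c} {σ : Sub b c} {τ : Sub a b} {σ'} → SSComp σ τ σ' →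
           SSComp (liftS σ) (liftS τ) (liftS σ')
liftSS-∘ h zero = var≈
liftSS-∘ {σ = σ} {τ} h (suc i) =
  ≈-trans (sub-ren (λ _ → ≈-refl) (τ i))
    (≈-trans (≈-sym (ren-sub {ρ = suc} {σ = σ} (λ _ → ≈-refl) (τ i))) (ren-cong (λ _ → refl) (h i)))

liftSSⁿ-∘ : ∀ {a b c} k {σ : Sub b c} {τ : Sub a b} {σ'} → SSComp σ τ σ' →
            SSComp (liftSⁿ k σ) (liftSⁿ k τ) (liftSⁿ k σ')
liftSSⁿ-∘ zero h = h
liftSSⁿ-∘ (suc k) h = liftSS-∘ (liftSSⁿ-∘ k h)

sub-sub : ∀ {a b c} {σ : Sub b c} {τ : Sub a b} {σ'} → SSComp σ τ σ' → ∀ t →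
          sub σ (sub τ t) ≈ sub σ' t
sub-sub h (var x) = h x
sub-sub h (app t s) = app≈ (sub-sub h t) (sub-sub h s)
sub-sub h (lam t) = lam≈ (sub-sub (liftSS-∘ h) t)
sub-sub h (efq t) = efq≈ (sub-sub h t)
sub-sub h (pair t s) = pair≈ (sub-sub h t) (sub-sub h s)
sub-sub h (π₁ t) = π₁≈ (sub-sub h t)
sub-sub h (π₂ t) = π₂≈ (sub-sub h t)
sub-sub h (in₁ t) = in₁≈ (sub-sub h t)
sub-sub h (in₂ t) = in₂≈ (sub-sub h t)
sub-sub h (case t s₁ s₂) = case≈ (sub-sub h t) (sub-sub (liftSS-∘ h) s₁) (sub-sub (liftSS-∘ h) s₂)
sub-sub h (V k t s₁ s₂ us) =
  V≈ (sub-sub (liftSSⁿ-∘ (suc k) h) t) (sub-sub (liftSS-∘ h) s₁)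
     (sub-sub (liftSS-∘ h) s₂) (λ j → sub-sub (liftSS-∘ h) (us j))

SVar : ∀ {a b} → Sub a b → Ren a b → Set
SVar σ ρ = ∀ i → σ i ≈ var (ρ i)

liftSV : ∀ {a b} {σ : Sub a b} {ρ} → SVar σ ρ → SVar (liftS σ) (liftR ρ)
liftSV h zero = var≈
liftSV h (suc i) = ren-cong (λ _ → refl) (h i)

liftSVⁿ : ∀ {a b} k {σ : Sub a b} {ρ} → SVar σ ρ → SVar (liftSⁿ k σ) (liftRⁿ k ρ)
liftSVⁿ zero h = h
liftSVⁿ (suc k) h = liftSV (liftSVⁿ k h)

sub-var : ∀ {a b} {σ : Sub a b} {ρ} → SVar σ ρ → ∀ t → sub σ t ≈ ren ρ t
sub-var h (var x) = h x
sub-var h (app t s) = app≈ (sub-var h t) (sub-var h s)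
sub-var h (lam t) = lam≈ (sub-var (liftSV h) t)
sub-var h (efq t) = efq≈ (sub-var h t)
sub-var h (pair t s) = pair≈ (sub-var h t) (sub-var h s)
sub-var h (π₁ t) = π₁≈ (sub-var h t)
sub-var h (π₂ t) = π₂≈ (sub-var h t)
sub-var h (in₁ t) = in₁≈ (sub-var h t)
sub-var h (in₂ t) = in₂≈ (sub-var h t)
sub-var h (case t s₁ s₂) = case≈ (sub-var h t) (sub-var (liftSV h) s₁) (sub-var (liftSV h) s₂)
sub-var h (V k t s₁ s₂ us) =
  V≈ (sub-var (liftSVⁿ (suc k) h) t) (sub-var (liftSV h) s₁)
     (sub-var (liftSV h) s₂) (λ j → sub-var (liftSV h) (us j))

RenId : ∀ {a} → Ren a a → Set
RenId ρ = ∀ i → ρ i ≡ i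

liftR-id : ∀ {a} {ρ : Ren a a} → RenId ρ → RenId (liftR ρ)
liftR-id h zero = refl
liftR-id h (suc i) = cong suc (h i)

liftRⁿ-id : ∀ {a} k {ρ : Ren a a} → RenId ρ → RenId (liftRⁿ k ρ)
liftRⁿ-id zero h = h
liftRⁿ-id (suc k) h = liftR-id (liftRⁿ-id k h)

ren-id : ∀ {a} {ρ : Ren a a} → RenId ρ → ∀ t → ren ρ t ≈ t
ren-id h (var x) = ≡⇒≈ (cong var (h x))
ren-id h (app t s) = app≈ (ren-id h t) (ren-id h s)
ren-id h (lam t) = lam≈ (ren-id (liftR-id h) t)
ren-id h (efq t) = efq≈ (ren-id h t)
ren-id h (pair t s) = pair≈ (ren-id h t) (ren-id h s)
ren-id h (π₁ t) = π₁≈ (ren-id h t)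
ren-id h (π₂ t) = π₂≈ (ren-id h t)
ren-id h (in₁ t) = in₁≈ (ren-id h t)
ren-id h (in₂ t) = in₂≈ (ren-id h t)
ren-id h (case t s₁ s₂) = case≈ (ren-id h t) (ren-id (liftR-id h) s₁) (ren-id (liftR-id h) s₂)
ren-id h (V k t s₁ s₂ us) =
  V≈ (ren-id (liftRⁿ-id (suc k) h) t) (ren-id (liftR-id h) s₁)
     (ren-id (liftR-id h) s₂) (λ j → ren-id (liftR-id h) (us j))

sub-id : ∀ {a} (t : Tm a) → sub var t ≈ t
sub-id t = ≈-trans (sub-var {ρ = λ i → i} (λ _ → var≈) t) (ren-id (λ _ → refl) t)

ext : ∀ {m n} → Sub m n → Tm n → Sub (suc m) n
ext σ a zero    = a
ext σ a (suc i) = σ i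

single-cong : ∀ {m} {a a' : Tm m} → a ≈ a' → SubEq (single a) (single a')
single-cong p zero    = p
single-cong p (suc i) = var≈

single-ren : ∀ {m n} (ρ : Ren m n) (s : Tm (suc m)) a →
             ren ρ (s [ a ]) ≈ (ren (liftR ρ) s) [ ren ρ a ]
single-ren {m} {n} ρ s a = ≈-trans (ren-sub {σ' = σ'} after s) (≈-sym (sub-ren before s))
  where
  σ' : Sub (suc m) n
  σ' i = single (ren ρ a) (liftR ρ i)
  after : RSComp ρ (single a) σ'
  after zero    = ≈-refl
  after (suc i) = var≈
  before : SRComp (single (ren ρ a)) (liftR ρ) σ'
  before i = ≈-refl

single-after-lift : ∀ {m n} (σ : Sub m n) s (t : Tm (suc m)) →
                    (sub (liftS σ) t) [ s ] ≈ sub (ext σ s) t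
single-after-lift σ s t = sub-sub composes t
  where
  composes : SSComp (single s) (liftS σ) (ext σ s)
  composes zero    = ≈-refl
  composes (suc i) = ≈-trans (sub-ren {σ' = var} (λ _ → var≈) (σ i)) (sub-id (σ i))

β-contractum : ∀ {m n k} (ρ : Ren n k) (σ : Sub m n) s (t : Tm (suc m)) →
               (ren (liftR ρ) (sub (liftS σ) t)) [ s ] ≈ sub (ext (λ i → ren ρ (σ i)) s) t
β-contractum ρ σ s t =
  ≈-trans (sub-cong (λ _ → ≈-refl) (ren-sub (liftRS-∘ (λ _ → ≈-refl)) t))
          (single-after-lift _ s t)

lams-cong : ∀ {m} n {t t' : Tm (n + m)} → t ≈ t' → lams n t ≈ lams n t'
lams-cong zero    p = p
lams-cong (suc n) p = lams-cong n (lam≈ p)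

ren-lams : ∀ {m k} n (ρ : Ren m k) t → ren ρ (lams n t) ≡ lams n (ren (liftRⁿ n ρ) t)
ren-lams zero    ρ t = refl
ren-lams (suc n) ρ t = ren-lams n ρ (lam t)

liftRⁿ-↑ˡ : ∀ {m m'} n (ρ : Ren m m') (j : Fin n) → liftRⁿ n ρ (j ↑ˡ m) ≡ j ↑ˡ m'
liftRⁿ-↑ˡ (suc n) ρ zero    = refl
liftRⁿ-↑ˡ (suc n) ρ (suc j) = cong suc (liftRⁿ-↑ˡ n ρ j)

liftSⁿ-↑ˡ : ∀ {m m'} n (σ : Sub m m') (j : Fin n) → liftSⁿ n σ (j ↑ˡ m) ≡ var (j ↑ˡ m')
liftSⁿ-↑ˡ (suc n) σ zero    = refl
liftSⁿ-↑ˡ (suc n) σ (suc j) = cong (ren suc) (liftSⁿ-↑ˡ n σ j)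

-- The body of a Visser term only mentions its own bound variables, so a
-- substitution for the outer scope does not affect it.
sub-bound-body : ∀ {m m'} n (σ : Sub m m') (t₀ : Tm n) →
                 sub (liftSⁿ n σ) (ren (wkBound m) t₀) ≈ ren (wkBound m') t₀
sub-bound-body n σ t₀ =
  ≈-trans (sub-ren {σ' = λ i → var (wkBound _ i)} (λ i → ≡⇒≈ (liftSⁿ-↑ˡ n σ i)) t₀)
          (sub-var (λ _ → var≈) t₀)

renW : ∀ {m n} → Ren m n → WCtx m → WCtx n
renW ρ hole            = hole
renW ρ (appW W s)      = appW (renW ρ W) (ren ρ s)
renW ρ (π₁W W)         = π₁W (renW ρ W)
renW ρ (π₂W W)         = π₂W (renW ρ W)
renW ρ (caseW W s₁ s₂) = caseW (renW ρ W) (ren (liftR ρ) s₁) (ren (liftR ρ) s₂)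

ren-plug : ∀ {m n} (ρ : Ren m n) W h → ren ρ (plug W h) ≡ plug (renW ρ W) (ren ρ h)
ren-plug ρ hole            h = refl
ren-plug ρ (appW W s)      h = cong (λ x → app x (ren ρ s)) (ren-plug ρ W h)
ren-plug ρ (π₁W W)         h = cong π₁ (ren-plug ρ W h)
ren-plug ρ (π₂W W)         h = cong π₂ (ren-plug ρ W h)
ren-plug ρ (caseW W s₁ s₂) h = cong (λ x → case x _ _) (ren-plug ρ W h)

plug-efq-≈ : ∀ {m} (W : WCtx m) {t b} → plug W (efq t) ≈ b →
             Σ (WCtx m) λ W' → Σ (Tm m) λ t' → (b ≡ plug W' (efq t')) × (t ≈ t')
plug-efq-≈ hole (efq≈ p) = hole , _ , refl , p
plug-efq-≈ (appW W s) (app≈ p q) with W' , t' , refl , r ← plug-efq-≈ W p =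
  appW W' _ , t' , refl , r
plug-efq-≈ (π₁W W) (π₁≈ p) with W' , t' , refl , r ← plug-efq-≈ W p =
  π₁W W' , t' , refl , r
plug-efq-≈ (π₂W W) (π₂≈ p) with W' , t' , refl , r ← plug-efq-≈ W p =
  π₂W W' , t' , refl , r
plug-efq-≈ (caseW W s₁ s₂) (case≈ p q r) with W' , t' , refl , r' ← plug-efq-≈ W p =
  caseW W' _ _ , t' , refl , r'

plug-var-≈ : ∀ {m} (W : WCtx m) {i t b} → plug W (app (var i) t) ≈ b →
             Σ (WCtx m) λ W' → Σ (Tm m) λ t' → (b ≡ plug W' (app (var i) t')) × (t ≈ t')
plug-var-≈ hole (app≈ var≈ p) = hole , _ , refl , p
plug-var-≈ (appW W s) (app≈ p q) with W' , t' , refl , r ← plug-var-≈ W p =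
  appW W' _ , t' , refl , r
plug-var-≈ (π₁W W) (π₁≈ p) with W' , t' , refl , r ← plug-var-≈ W p =
  π₁W W' , t' , refl , r
plug-var-≈ (π₂W W) (π₂≈ p) with W' , t' , refl , r ← plug-var-≈ W p =
  π₂W W' , t' , refl , r
plug-var-≈ (caseW W s₁ s₂) (case≈ p q r) with W' , t' , refl , r' ← plug-var-≈ W p =
  caseW W' _ _ , t' , refl , r'

updateAt-≈ : ∀ {m n} {us us' : Vector (Tm m) n} (j : Fin n) {u u'} →
             (∀ i → us i ≈ us' i) → u ≈ u' →
             ∀ i → updateAt us j (λ _ → u) i ≈ updateAt us' j (λ _ → u') i
updateAt-≈ zero    h p zero    = p
updateAt-≈ zero    h p (suc i) = h (suc i)
updateAt-≈ (suc j) h p zero    = h zero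
updateAt-≈ (suc j) h p (suc i) = updateAt-≈ j (λ i → h (suc i)) p i

updateAt-map : ∀ {m m' n} (f : Tm m → Tm m') (us : Vector (Tm m) n) (j : Fin n) {u u'} →
               u' ≈ f u →
               ∀ i → updateAt (λ i → f (us i)) j (λ _ → u') i ≈ f (updateAt us j (λ _ → u) i)
updateAt-map f us zero    p zero    = p
updateAt-map f us zero    p (suc i) = ≈-refl
updateAt-map f us (suc j) p zero    = ≈-refl
updateAt-map f us (suc j) p (suc i) = updateAt-map f (tail us) j p i

⟶-resp-≈ : ∀ {m} {t t' u : Tm m} → t ⟶ u → t ≈ t' →
           Σ (Tm m) λ u' → (t' ⟶ u') × (u ≈ u')
⟶-resp-≈ β      (app≈ (lam≈ p) q)     = _ , β , sub-cong (single-cong q) p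
⟶-resp-≈ π₁β    (π₁≈ (pair≈ p q))     = _ , π₁β , p
⟶-resp-≈ π₂β    (π₂≈ (pair≈ p q))     = _ , π₂β , q
⟶-resp-≈ case₁β (case≈ (in₁≈ p) q r)  = _ , case₁β , sub-cong (single-cong p) q
⟶-resp-≈ case₂β (case≈ (in₂≈ p) q r)  = _ , case₂β , sub-cong (single-cong p) r
⟶-resp-≈ V-in₁  (V≈ {k} (in₁≈ p) q r f) =
  _ , V-in₁ , sub-cong (single-cong (lams-cong (suc k) p)) q
⟶-resp-≈ V-in₂  (V≈ {k} (in₂≈ p) q r f) =
  _ , V-in₂ , sub-cong (single-cong (lams-cong (suc k) p)) r
⟶-resp-≈ (V-efq W) (V≈ {k} p q r f) with W' , _ , refl , pt ← plug-efq-≈ W p =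
  _ , V-efq W' , sub-cong (single-cong (lams-cong (suc k) (efq≈ pt))) q
⟶-resp-≈ (V-var W j) (V≈ {k} p q r f) with W' , _ , refl , pt ← plug-var-≈ W p =
  _ , V-var W' j , sub-cong (single-cong (lams-cong (suc k) pt)) (f j)
⟶-resp-≈ (appˡ s) (app≈ p q) with _ , s' , e ← ⟶-resp-≈ s p = _ , appˡ s' , app≈ e q
⟶-resp-≈ (appʳ s) (app≈ p q) with _ , s' , e ← ⟶-resp-≈ s q = _ , appʳ s' , app≈ p e
⟶-resp-≈ (lamᶜ s) (lam≈ p) with _ , s' , e ← ⟶-resp-≈ s p = _ , lamᶜ s' , lam≈ e
⟶-resp-≈ (efqᶜ s) (efq≈ p) with _ , s' , e ← ⟶-resp-≈ s p = _ , efqᶜ s' , efq≈ e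
⟶-resp-≈ (pairˡ s) (pair≈ p q) with _ , s' , e ← ⟶-resp-≈ s p = _ , pairˡ s' , pair≈ e q
⟶-resp-≈ (pairʳ s) (pair≈ p q) with _ , s' , e ← ⟶-resp-≈ s q = _ , pairʳ s' , pair≈ p e
⟶-resp-≈ (π₁ᶜ s) (π₁≈ p)  with _ , s' , e ← ⟶-resp-≈ s p = _ , π₁ᶜ s' , π₁≈ e
⟶-resp-≈ (π₂ᶜ s) (π₂≈ p)  with _ , s' , e ← ⟶-resp-≈ s p = _ , π₂ᶜ s' , π₂≈ e
⟶-resp-≈ (in₁ᶜ s) (in₁≈ p) with _ , s' , e ← ⟶-resp-≈ s p = _ , in₁ᶜ s' , in₁≈ e
⟶-resp-≈ (in₂ᶜ s) (in₂≈ p) with _ , s' , e ← ⟶-resp-≈ s p = _ , in₂ᶜ s' , in₂≈ e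
⟶-resp-≈ (caseᶜ s) (case≈ p q r) with _ , s' , e ← ⟶-resp-≈ s p =
  _ , caseᶜ s' , case≈ e q r
⟶-resp-≈ (case₁ᶜ s) (case≈ p q r) with _ , s' , e ← ⟶-resp-≈ s q =
  _ , case₁ᶜ s' , case≈ p e r
⟶-resp-≈ (case₂ᶜ s) (case≈ p q r) with _ , s' , e ← ⟶-resp-≈ s r =
  _ , case₂ᶜ s' , case≈ p q e
⟶-resp-≈ (Vᶜ s) (V≈ p q r f)  with _ , s' , e ← ⟶-resp-≈ s p = _ , Vᶜ s' , V≈ e q r f
⟶-resp-≈ (V₁ᶜ s) (V≈ p q r f) with _ , s' , e ← ⟶-resp-≈ s q = _ , V₁ᶜ s' , V≈ p e r f
⟶-resp-≈ (V₂ᶜ s) (V≈ p q r f) with _ , s' , e ← ⟶-resp-≈ s r = _ , V₂ᶜ s' , V≈ p q e f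
⟶-resp-≈ (Vuᶜ j s) (V≈ p q r f) with _ , s' , e ← ⟶-resp-≈ s (f j) =
  _ , Vuᶜ j s' , V≈ p q r (updateAt-≈ j f e)

⟶*-resp-≈ : ∀ {m} {t t' u : Tm m} → t ≈ t' → t ⟶* u →
            Σ (Tm m) λ u' → (t' ⟶* u') × (u ≈ u')
⟶*-resp-≈ p ε = _ , ε , p
⟶*-resp-≈ p (s ◅ ss) with _ , s' , e ← ⟶-resp-≈ s p
  with _ , ss' , e' ← ⟶*-resp-≈ e ss = _ , s' ◅ ss' , e'

⟶*-transport : ∀ {m} {t t' w : Tm m} → t ≈ t' → t ⟶* w → VFree w → t' ⟶* w
⟶*-transport p r v with _ , r' , e ← ⟶*-resp-≈ p r
  with refl ← VFree-≈⇒≡ e v = r'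

V-efq-at : ∀ {m k} (W : WCtx (suc k + m)) {b t s₁ s₂ us} → b ≡ plug W (efq t) →
           V k b s₁ s₂ us ⟶ s₁ [ lams (suc k) (efq t) ]
V-efq-at W refl = V-efq W

V-var-at : ∀ {m k} (W : WCtx (suc k + m)) (j : Fin (suc k)) {b t s₁ s₂ us} →
           b ≡ plug W (app (var (j ↑ˡ m)) t) → V k b s₁ s₂ us ⟶ us j [ lams (suc k) t ]
V-var-at W j refl = V-var W j

ren-contractum : ∀ {m n k} (ρ : Ren m n) (s : Tm (suc m)) (t : Tm (suc k + m)) →
                 ren ρ (s [ lams (suc k) t ]) ≈
                 ren (liftR ρ) s [ lams (suc k) (ren (liftRⁿ (suc k) ρ) t) ]
ren-contractum {k = k} ρ s t =
  ≈-trans (single-ren ρ s (lams (suc k) t))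
          (≡⇒≈ (cong (λ x → ren (liftR ρ) s [ x ]) (ren-lams (suc k) ρ t)))

ren-⟶ : ∀ {m n} (ρ : Ren m n) {t u : Tm m} → t ⟶ u →
        Σ (Tm n) λ u' → (ren ρ t ⟶ u') × (u' ≈ ren ρ u)
ren-⟶ ρ (β {t} {s})            = _ , β , ≈-sym (single-ren ρ t s)
ren-⟶ ρ π₁β                    = _ , π₁β , ≈-refl
ren-⟶ ρ π₂β                    = _ , π₂β , ≈-refl
ren-⟶ ρ (case₁β {t} {s₁})      = _ , case₁β , ≈-sym (single-ren ρ s₁ t)
ren-⟶ ρ (case₂β {t} {s₁} {s₂}) = _ , case₂β , ≈-sym (single-ren ρ s₂ t)
ren-⟶ ρ (V-in₁ {k} {t} {s₁})   = _ , V-in₁ , ≈-sym (ren-contractum ρ s₁ t)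
ren-⟶ ρ (V-in₂ {k} {t} {s₁} {s₂}) = _ , V-in₂ , ≈-sym (ren-contractum ρ s₂ t)
ren-⟶ {m} {n} ρ (V-efq {k} W {t} {s₁}) =
  _ , V-efq-at (renW ρⁿ W) (ren-plug ρⁿ W (efq t)) , ≈-sym (ren-contractum ρ s₁ (efq t))
  where
  ρⁿ : Ren (suc k + m) (suc k + n)
  ρⁿ = liftRⁿ (suc k) ρ
ren-⟶ {m} {n} ρ (V-var {k} W j {t} {s₁} {s₂} {us}) =
  _ , V-var-at (renW ρⁿ W) j renamed-redex , ≈-sym (ren-contractum ρ (us j) t)
  where
  ρⁿ : Ren (suc k + m) (suc k + n)
  ρⁿ = liftRⁿ (suc k) ρ
  renamed-redex : ren ρⁿ (plug W (app (var (j ↑ˡ m)) t)) ≡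
                  plug (renW ρⁿ W) (app (var (j ↑ˡ _)) (ren ρⁿ t))
  renamed-redex =
    trans (ren-plug ρⁿ W (app (var (j ↑ˡ m)) t))
          (cong (λ i → plug (renW ρⁿ W) (app (var i) (ren ρⁿ t))) (liftRⁿ-↑ˡ (suc k) ρ j))
ren-⟶ ρ (appˡ s)  with _ , s' , e ← ren-⟶ ρ s = _ , appˡ s' , app≈ e ≈-refl
ren-⟶ ρ (appʳ s)  with _ , s' , e ← ren-⟶ ρ s = _ , appʳ s' , app≈ ≈-refl e
ren-⟶ ρ (lamᶜ s)  with _ , s' , e ← ren-⟶ (liftR ρ) s = _ , lamᶜ s' , lam≈ e
ren-⟶ ρ (efqᶜ s)  with _ , s' , e ← ren-⟶ ρ s = _ , efqᶜ s' , efq≈ e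
ren-⟶ ρ (pairˡ s) with _ , s' , e ← ren-⟶ ρ s = _ , pairˡ s' , pair≈ e ≈-refl
ren-⟶ ρ (pairʳ s) with _ , s' , e ← ren-⟶ ρ s = _ , pairʳ s' , pair≈ ≈-refl e
ren-⟶ ρ (π₁ᶜ s)   with _ , s' , e ← ren-⟶ ρ s = _ , π₁ᶜ s' , π₁≈ e
ren-⟶ ρ (π₂ᶜ s)   with _ , s' , e ← ren-⟶ ρ s = _ , π₂ᶜ s' , π₂≈ e
ren-⟶ ρ (in₁ᶜ s)  with _ , s' , e ← ren-⟶ ρ s = _ , in₁ᶜ s' , in₁≈ e
ren-⟶ ρ (in₂ᶜ s)  with _ , s' , e ← ren-⟶ ρ s = _ , in₂ᶜ s' , in₂≈ e
ren-⟶ ρ (caseᶜ s) with _ , s' , e ← ren-⟶ ρ s = _ , caseᶜ s' , case≈ e ≈-refl ≈-refl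
ren-⟶ ρ (case₁ᶜ s) with _ , s' , e ← ren-⟶ (liftR ρ) s =
  _ , case₁ᶜ s' , case≈ ≈-refl e ≈-refl
ren-⟶ ρ (case₂ᶜ s) with _ , s' , e ← ren-⟶ (liftR ρ) s =
  _ , case₂ᶜ s' , case≈ ≈-refl ≈-refl e
ren-⟶ ρ (Vᶜ {k} s) with _ , s' , e ← ren-⟶ (liftRⁿ (suc k) ρ) s =
  _ , Vᶜ s' , V≈ e ≈-refl ≈-refl (λ _ → ≈-refl)
ren-⟶ ρ (V₁ᶜ s) with _ , s' , e ← ren-⟶ (liftR ρ) s =
  _ , V₁ᶜ s' , V≈ ≈-refl e ≈-refl (λ _ → ≈-refl)
ren-⟶ ρ (V₂ᶜ s) with _ , s' , e ← ren-⟶ (liftR ρ) s =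
  _ , V₂ᶜ s' , V≈ ≈-refl ≈-refl e (λ _ → ≈-refl)
ren-⟶ ρ (Vuᶜ {us = us} j s) with _ , s' , e ← ren-⟶ (liftR ρ) s =
  _ , Vuᶜ j s' , V≈ ≈-refl ≈-refl ≈-refl (updateAt-map (ren (liftR ρ)) us j e)

ren-⟶* : ∀ {m n} (ρ : Ren m n) {t u : Tm m} → t ⟶* u →
         Σ (Tm n) λ v → (ren ρ t ⟶* v) × (v ≈ ren ρ u)
ren-⟶* ρ ε = _ , ε , ≈-refl
ren-⟶* ρ (s ◅ ss)
  with _ , s' , e₁ ← ren-⟶ ρ s
     | _ , ss' , e₂ ← ren-⟶* ρ ss
  with _ , ss'' , e₃ ← ⟶*-resp-≈ (≈-sym e₁) ss' =
  _ , s' ◅ ss'' , ≈-trans (≈-sym e₃) e₂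

ren-⟶*-exact : ∀ {m n} (ρ : Ren m n) {t w : Tm m} → t ⟶* w → VFree w → ren ρ t ⟶* ren ρ w
ren-⟶*-exact ρ {w = w} r v with _ , r' , e ← ren-⟶* ρ r
  with refl ← VFree-≈⇒≡ (≈-sym e) (VFree-ren ρ w v) = r'

-- Normal and neutral terms.  Nf/Ne describe the V-free normal forms; the
-- theorem only needs that they are normal, V-free and stable under renaming.

mutual
  data Ne : ∀ {m} → Tm m → Set where
    nvar  : ∀ {m} {i : Fin m} → Ne (var i)
    napp  : ∀ {m} {n v : Tm m} → Ne n → Nf v → Ne (app n v)
    nπ₁   : ∀ {m} {n : Tm m} → Ne n → Ne (π₁ n)
    nπ₂   : ∀ {m} {n : Tm m} → Ne n → Ne (π₂ n)
    ncase : ∀ {m} {n : Tm m} {v₁ v₂} → Ne n → Nf v₁ → Nf v₂ → Ne (case n v₁ v₂)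
    nefq  : ∀ {m} {v : Tm m} → Nf v → Ne (efq v)

  data Nf : ∀ {m} → Tm m → Set where
    ne    : ∀ {m} {n : Tm m} → Ne n → Nf n
    nlam  : ∀ {m} {v : Tm (suc m)} → Nf v → Nf (lam v)
    npair : ∀ {m} {v w : Tm m} → Nf v → Nf w → Nf (pair v w)
    nin₁  : ∀ {m} {v : Tm m} → Nf v → Nf (in₁ v)
    nin₂  : ∀ {m} {v : Tm m} → Nf v → Nf (in₂ v)

mutual
  ne-normal : ∀ {m} {n u : Tm m} → Ne n → ¬ (n ⟶ u)
  ne-normal (napp p q)    (appˡ s)   = ne-normal p s
  ne-normal (napp p q)    (appʳ s)   = nf-normal q s
  ne-normal (nπ₁ p)       (π₁ᶜ s)    = ne-normal p s
  ne-normal (nπ₂ p)       (π₂ᶜ s)    = ne-normal p s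
  ne-normal (ncase p q r) (caseᶜ s)  = ne-normal p s
  ne-normal (ncase p q r) (case₁ᶜ s) = nf-normal q s
  ne-normal (ncase p q r) (case₂ᶜ s) = nf-normal r s
  ne-normal (nefq p)      (efqᶜ s)   = nf-normal p s

  nf-normal : ∀ {m} {n u : Tm m} → Nf n → ¬ (n ⟶ u)
  nf-normal (ne p)      s         = ne-normal p s
  nf-normal (nlam p)    (lamᶜ s)  = nf-normal p s
  nf-normal (npair p q) (pairˡ s) = nf-normal p s
  nf-normal (npair p q) (pairʳ s) = nf-normal q s
  nf-normal (nin₁ p)    (in₁ᶜ s)  = nf-normal p s
  nf-normal (nin₂ p)    (in₂ᶜ s)  = nf-normal p s

mutual
  ne-VFree : ∀ {m} {n : Tm m} → Ne n → VFree n
  ne-VFree nvar          = tt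
  ne-VFree (napp p q)    = ne-VFree p , nf-VFree q
  ne-VFree (nπ₁ p)       = ne-VFree p
  ne-VFree (nπ₂ p)       = ne-VFree p
  ne-VFree (ncase p q r) = ne-VFree p , nf-VFree q , nf-VFree r
  ne-VFree (nefq p)      = nf-VFree p

  nf-VFree : ∀ {m} {n : Tm m} → Nf n → VFree n
  nf-VFree (ne p)      = ne-VFree p
  nf-VFree (nlam p)    = nf-VFree p
  nf-VFree (npair p q) = nf-VFree p , nf-VFree q
  nf-VFree (nin₁ p)    = nf-VFree p
  nf-VFree (nin₂ p)    = nf-VFree p

mutual
  ne-ren : ∀ {m k} (ρ : Ren m k) {n : Tm m} → Ne n → Ne (ren ρ n)
  ne-ren ρ nvar          = nvar
  ne-ren ρ (napp p q)    = napp (ne-ren ρ p) (nf-ren ρ q)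
  ne-ren ρ (nπ₁ p)       = nπ₁ (ne-ren ρ p)
  ne-ren ρ (nπ₂ p)       = nπ₂ (ne-ren ρ p)
  ne-ren ρ (ncase p q r) = ncase (ne-ren ρ p) (nf-ren (liftR ρ) q) (nf-ren (liftR ρ) r)
  ne-ren ρ (nefq p)      = nefq (nf-ren ρ p)

  nf-ren : ∀ {m k} (ρ : Ren m k) {n : Tm m} → Nf n → Nf (ren ρ n)
  nf-ren ρ (ne p)      = ne (ne-ren ρ p)
  nf-ren ρ (nlam p)    = nlam (nf-ren (liftR ρ) p)
  nf-ren ρ (npair p q) = npair (nf-ren ρ p) (nf-ren ρ q)
  nf-ren ρ (nin₁ p)    = nin₁ (nf-ren ρ p)
  nf-ren ρ (nin₂ p)    = nin₂ (nf-ren ρ p)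

-- Typing of V-free terms.  The Visser rule types its body in a fixed
-- context, so weakening is only stated (and only needed) for V-free terms.

Wk : ∀ {m n} → Ren m n → Ctx m → Ctx n → Set
Wk ρ Γ Δ = ∀ i → lookup Δ (ρ i) ≡ lookup Γ i

Wk-lift : ∀ {m n} {ρ : Ren m n} {Γ Δ} A → Wk ρ Γ Δ → Wk (liftR ρ) (A ∷ Γ) (A ∷ Δ)
Wk-lift A w zero    = refl
Wk-lift A w (suc i) = w i

ren-⊢ : ∀ {m n} {ρ : Ren m n} {Γ Δ} {t A} → VFree t → Γ ⊢ t ∶ A → Wk ρ Γ Δ → Δ ⊢ ren ρ t ∶ A
ren-⊢ {ρ = ρ} {Δ = Δ} v (ax i) w = subst (λ X → Δ ⊢ var (ρ i) ∶ X) (w i) (ax (ρ i))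
ren-⊢ v           (⇒I d)     w = ⇒I (ren-⊢ v d (Wk-lift _ w))
ren-⊢ (v₁ , v₂)   (⇒E d e)   w = ⇒E (ren-⊢ v₁ d w) (ren-⊢ v₂ e w)
ren-⊢ (v₁ , v₂)   (∧I d e)   w = ∧I (ren-⊢ v₁ d w) (ren-⊢ v₂ e w)
ren-⊢ v           (∧E₁ d)    w = ∧E₁ (ren-⊢ v d w)
ren-⊢ v           (∧E₂ d)    w = ∧E₂ (ren-⊢ v d w)
ren-⊢ v           (∨I₁ d)    w = ∨I₁ (ren-⊢ v d w)
ren-⊢ v           (∨I₂ d)    w = ∨I₂ (ren-⊢ v d w)
ren-⊢ (v₁ , v₂ , v₃) (∨E d e f) w =
  ∨E (ren-⊢ v₁ d w) (ren-⊢ v₂ e (Wk-lift _ w)) (ren-⊢ v₃ f (Wk-lift _ w))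
ren-⊢ v           (⊥E d)     w = ⊥E (ren-⊢ v d w)

lams-⊢ : ∀ {m} n (Θ : Vec Form n) E {Γ : Ctx m} (b : Tm (n + m)) →
         (Θ ++ Γ) ⊢ b ∶ E → Γ ⊢ lams n b ∶ arrows Θ E
lams-⊢ zero    []      E b d = d
lams-⊢ (suc n) (A ∷ Θ) E b d = lams-⊢ n Θ (A ⇒ E) (lam b) (⇒I d)

WN : ∀ {m} → Ctx m → Form → Tm m → Set
WN Γ A t = Σ _ λ t' → (t ⟶* t') × Nf t' × (Γ ⊢ t' ∶ A)

mutual
  Red : Form → ∀ {m} → Ctx m → Tm m → Set
  Red A Γ t = WN Γ A t × Red⁺ A Γ t

  Red⁺ : Form → ∀ {m} → Ctx m → Tm m → Set
  Red⁺ (atom _) Γ t = ⊤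
  Red⁺ ⊥'       Γ t = ⊤
  Red⁺ (A ⇒ B) {m} Γ t =
    ∀ {n} {Δ : Ctx n} (ρ : Ren m n) → Wk ρ Γ Δ → ∀ s → Red A Δ s → Red B Δ (app (ren ρ t) s)
  Red⁺ (A ∧' B) Γ t = Red A Γ (π₁ t) × Red B Γ (π₂ t)
  Red⁺ (A ∨' B) Γ t =
    (Σ _ λ s → (t ⟶* in₁ s) × Red A Γ s) ⊎
    (Σ _ λ s → (t ⟶* in₂ s) × Red B Γ s) ⊎
    (Σ _ λ n → (t ⟶* n) × Ne n × (Γ ⊢ n ∶ A ∨' B))

WN-resp : ∀ {m} {Γ : Ctx m} {A t t'} → WN Γ A t → t ≈ t' → WN Γ A t'
WN-resp (n , r , nf , d) p = n , ⟶*-transport p r (nf-VFree nf) , nf , d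

resp : ∀ A {m} {Γ : Ctx m} {t t'} → Red A Γ t → t ≈ t' → Red A Γ t'
resp (atom _) (w , _) p = WN-resp w p , tt
resp ⊥'       (w , _) p = WN-resp w p , tt
resp (A ⇒ B)  (w , f) p =
  WN-resp w p , λ ρ wk s rs → resp B (f ρ wk s rs) (app≈ (ren-cong (λ _ → refl) p) ≈-refl)
resp (A ∧' B) (w , r₁ , r₂) p = WN-resp w p , resp A r₁ (π₁≈ p) , resp B r₂ (π₂≈ p)
resp (A ∨' B) (w , inj₁ (s , r , rs)) p with _ , r' , in₁≈ q ← ⟶*-resp-≈ p r =
  WN-resp w p , inj₁ (_ , r' , resp A rs q)
resp (A ∨' B) (w , inj₂ (inj₁ (s , r , rs))) p with _ , r' , in₂≈ q ← ⟶*-resp-≈ p r =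
  WN-resp w p , inj₂ (inj₁ (_ , r' , resp B rs q))
resp (A ∨' B) (w , inj₂ (inj₂ (n , r , nn , d))) p =
  WN-resp w p , inj₂ (inj₂ (n , ⟶*-transport p r (ne-VFree nn) , nn , d))

expand : ∀ A {m} {Γ : Ctx m} {t t'} → t ⟶* t' → Red A Γ t' → Red A Γ t
expand A {Γ = Γ} {t} r (w , e) = WN-expand w , expand⁺ A e
  where
  WN-expand : ∀ {A} → WN Γ A _ → WN Γ A t
  WN-expand (n , r' , nf , d) = n , r ◅◅ r' , nf , d
  expand⁺ : ∀ A → Red⁺ A Γ _ → Red⁺ A Γ t
  expand⁺ (atom _) _ = tt
  expand⁺ ⊥'       _ = tt
  expand⁺ (A ⇒ B)  f ρ wk s rs with _ , r' , e ← ren-⟶* ρ r =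
    expand B (gmap (λ x → app x s) appˡ r') (resp B (f ρ wk s rs) (app≈ (≈-sym e) ≈-refl))
  expand⁺ (A ∧' B) (r₁ , r₂) = expand A (gmap π₁ π₁ᶜ r) r₁ , expand B (gmap π₂ π₂ᶜ r) r₂
  expand⁺ (A ∨' B) (inj₁ (s , r' , rs))        = inj₁ (s , r ◅◅ r' , rs)
  expand⁺ (A ∨' B) (inj₂ (inj₁ (s , r' , rs))) = inj₂ (inj₁ (s , r ◅◅ r' , rs))
  expand⁺ (A ∨' B) (inj₂ (inj₂ (n , r' , nd))) = inj₂ (inj₂ (n , r ◅◅ r' , nd))

WN-mono : ∀ {m n} {Γ : Ctx m} {Δ : Ctx n} {ρ A t} → Wk ρ Γ Δ → WN Γ A t → WN Δ A (ren ρ t)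
WN-mono {ρ = ρ} wk (n , r , nf , d) =
  ren ρ n , ren-⟶*-exact ρ r (nf-VFree nf) , nf-ren ρ nf , ren-⊢ (nf-VFree nf) d wk

mono : ∀ A {m n} {Γ : Ctx m} {Δ : Ctx n} {ρ t} → Wk ρ Γ Δ → Red A Γ t → Red A Δ (ren ρ t)
mono (atom _) wk (w , _) = WN-mono wk w , tt
mono ⊥'       wk (w , _) = WN-mono wk w , tt
mono (A ⇒ B) {ρ = ρ} {t} wk (w , f) = WN-mono wk w , λ ρ' wk' s rs →
  resp B (f (λ i → ρ' (ρ i)) (λ i → trans (wk' (ρ i)) (wk i)) s rs)
         (app≈ (≈-sym (ren-ren (λ _ → refl) t)) ≈-refl)
mono (A ∧' B) wk (w , r₁ , r₂) = WN-mono wk w , mono A wk r₁ , mono B wk r₂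
mono (A ∨' B) {ρ = ρ} wk (w , inj₁ (s , r , rs)) with _ , r' , in₁≈ q ← ren-⟶* ρ r =
  WN-mono wk w , inj₁ (_ , r' , resp A (mono A wk rs) (≈-sym q))
mono (A ∨' B) {ρ = ρ} wk (w , inj₂ (inj₁ (s , r , rs))) with _ , r' , in₂≈ q ← ren-⟶* ρ r =
  WN-mono wk w , inj₂ (inj₁ (_ , r' , resp B (mono B wk rs) (≈-sym q)))
mono (A ∨' B) {ρ = ρ} wk (w , inj₂ (inj₂ (n , r , nn , d))) =
  WN-mono wk w ,
  inj₂ (inj₂ (ren ρ n , ren-⟶*-exact ρ r (ne-VFree nn) , ne-ren ρ nn , ren-⊢ (ne-VFree nn) d wk))

reflect : ∀ A {m} {Γ : Ctx m} {n} → Ne n → Γ ⊢ n ∶ A → Red A Γ n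
reflect (atom _) nn d = (_ , ε , ne nn , d) , tt
reflect ⊥'       nn d = (_ , ε , ne nn , d) , tt
reflect (A ⇒ B) {n = n} nn d = (_ , ε , ne nn , d) ,
  λ { ρ wk s ((s' , r , nfs , ds) , _) →
        expand B (gmap (app (ren ρ n)) appʳ r)
          (reflect B (napp (ne-ren ρ nn) nfs) (⇒E (ren-⊢ (ne-VFree nn) d wk) ds)) }
reflect (A ∧' B) nn d =
  (_ , ε , ne nn , d) , reflect A (nπ₁ nn) (∧E₁ d) , reflect B (nπ₂ nn) (∧E₂ d)
reflect (A ∨' B) nn d = (_ , ε , ne nn , d) , inj₂ (inj₂ (_ , ε , nn , d))

RedSub : ∀ {m n} → Ctx m → Sub m n → Ctx n → Set
RedSub Γ σ Δ = ∀ i → Red (lookup Γ i) Δ (σ i)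

record Sem {m} (Γ : Ctx m) (t : Tm m) (A : Form) : Set where
  constructor sem
  field run : ∀ {n} {Δ : Ctx n} (σ : Sub m n) → RedSub Γ σ Δ → Red A Δ (sub σ t)
open Sem

id-RedSub : ∀ {m} {Γ : Ctx m} → RedSub Γ var Γ
id-RedSub {Γ = Γ} i = reflect (lookup Γ i) nvar (ax i)

lift-RedSub : ∀ {m n} {Γ : Ctx m} {σ} {Δ : Ctx n} A → RedSub Γ σ Δ →
              RedSub (A ∷ Γ) (liftS σ) (A ∷ Δ)
lift-RedSub A rs zero = reflect A nvar (ax zero)
lift-RedSub {Γ = Γ} A rs (suc i) = mono (lookup Γ i) (λ _ → refl) (rs i)

ext-RedSub : ∀ {m n} {Γ : Ctx m} {σ} {Δ : Ctx n} {A a} →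
             RedSub Γ σ Δ → Red A Δ a → RedSub (A ∷ Γ) (ext σ a) Δ
ext-RedSub rs ra zero    = ra
ext-RedSub rs ra (suc i) = rs i

ren-RedSub : ∀ {m n k} {Γ : Ctx m} {σ} {Δ : Ctx n} {Δ' : Ctx k} {ρ} →
             Wk ρ Δ Δ' → RedSub Γ σ Δ → RedSub Γ (λ i → ren ρ (σ i)) Δ'
ren-RedSub {Γ = Γ} wk rs i = mono (lookup Γ i) wk (rs i)

body-WN : ∀ {m n} {Γ : Ctx m} {Δ : Ctx n} {A B σ t} →
          Sem (A ∷ Γ) t B → RedSub Γ σ Δ → WN (A ∷ Δ) B (sub (liftS σ) t)
body-WN {A = A} ih rs = proj₁ (ih .run _ (lift-RedSub A rs))

instantiate : ∀ {m n} {Γ : Ctx m} {Δ : Ctx n} {A D σ a s} →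
              Sem (A ∷ Γ) s D → RedSub Γ σ Δ → Red A Δ a → Red D Δ (sub (liftS σ) s [ a ])
instantiate {D = D} {σ = σ} {a} {s} ih rs ra =
  resp D (ih .run (ext σ a) (ext-RedSub rs ra)) (≈-sym (single-after-lift σ a s))

varS : ∀ {m} {Γ : Ctx m} i → Sem Γ (var i) (lookup Γ i)
varS i .run σ rs = rs i

lamS : ∀ {m} {Γ : Ctx m} {A B t} → Sem (A ∷ Γ) t B → Sem Γ (lam t) (A ⇒ B)
lamS {Γ = Γ} {B = B} {t} ih .run σ rs with b , r , nf , d ← body-WN ih rs =
  (lam b , gmap lam lamᶜ r , nlam nf , ⇒I d) ,
  λ ρ wk s ra → expand B (β ◅ ε)
    (resp B (ih .run (ext (λ i → ren ρ (σ i)) s) (ext-RedSub (ren-RedSub {Γ = Γ} wk rs) ra))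
            (≈-sym (β-contractum ρ σ s t)))

appS : ∀ {m} {Γ : Ctx m} {A B t s} → Sem Γ t (A ⇒ B) → Sem Γ s A → Sem Γ (app t s) B
appS {B = B} {t} {s} ih₁ ih₂ .run σ rs =
  resp B (proj₂ (ih₁ .run σ rs) (λ i → i) (λ _ → refl) (sub σ s) (ih₂ .run σ rs))
         (app≈ (ren-id (λ _ → refl) (sub σ t)) ≈-refl)

pairS : ∀ {m} {Γ : Ctx m} {A B t s} → Sem Γ t A → Sem Γ s B → Sem Γ (pair t s) (A ∧' B)
pairS {A = A} {B} {s = s} ih₁ ih₂ .run σ rs
  with ra@((a , r₁ , nf₁ , d₁) , _) ← ih₁ .run σ rs
     | rb@((b , r₂ , nf₂ , d₂) , _) ← ih₂ .run σ rs =
  (pair a b , gmap (λ x → pair x (sub σ s)) pairˡ r₁ ◅◅ gmap (pair a) pairʳ r₂ ,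
   npair nf₁ nf₂ , ∧I d₁ d₂) ,
  expand A (π₁β ◅ ε) ra , expand B (π₂β ◅ ε) rb

fstS : ∀ {m} {Γ : Ctx m} {A B t} → Sem Γ t (A ∧' B) → Sem Γ (π₁ t) A
fstS ih .run σ rs = proj₁ (proj₂ (ih .run σ rs))

sndS : ∀ {m} {Γ : Ctx m} {A B t} → Sem Γ t (A ∧' B) → Sem Γ (π₂ t) B
sndS ih .run σ rs = proj₂ (proj₂ (ih .run σ rs))

inlS : ∀ {m} {Γ : Ctx m} {A B t} → Sem Γ t A → Sem Γ (in₁ t) (A ∨' B)
inlS ih .run σ rs with ra@((a , r , nf , d) , _) ← ih .run σ rs =
  (in₁ a , gmap in₁ in₁ᶜ r , nin₁ nf , ∨I₁ d) , inj₁ (_ , ε , ra)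

inrS : ∀ {m} {Γ : Ctx m} {A B t} → Sem Γ t B → Sem Γ (in₂ t) (A ∨' B)
inrS ih .run σ rs with ra@((a , r , nf , d) , _) ← ih .run σ rs =
  (in₂ a , gmap in₂ in₂ᶜ r , nin₂ nf , ∨I₂ d) , inj₂ (inj₁ (_ , ε , ra))

caseS : ∀ {m} {Γ : Ctx m} {A B D t s₁ s₂} →
        Sem Γ t (A ∨' B) → Sem (A ∷ Γ) s₁ D → Sem (B ∷ Γ) s₂ D → Sem Γ (case t s₁ s₂) D
caseS {D = D} ih ih₁ ih₂ .run σ rs with ih .run σ rs
... | _ , inj₁ (a , r , ra) =
  expand D (gmap (λ x → case x _ _) caseᶜ r ◅◅ (case₁β ◅ ε)) (instantiate ih₁ rs ra)
... | _ , inj₂ (inj₁ (a , r , ra)) =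
  expand D (gmap (λ x → case x _ _) caseᶜ r ◅◅ (case₂β ◅ ε)) (instantiate ih₂ rs ra)
... | _ , inj₂ (inj₂ (n , r , nn , d))
  with b₁ , r₁ , nf₁ , d₁ ← body-WN ih₁ rs
     | b₂ , r₂ , nf₂ , d₂ ← body-WN ih₂ rs =
  expand D (gmap (λ x → case x _ _) caseᶜ r ◅◅
            gmap (λ x → case n x _) case₁ᶜ r₁ ◅◅ gmap (case n b₁) case₂ᶜ r₂)
         (reflect D (ncase nn nf₁ nf₂) (∨E d d₁ d₂))

efqS : ∀ {m} {Γ : Ctx m} {A t} → Sem Γ t ⊥' → Sem Γ (efq t) A
efqS {A = A} ih .run σ rs with (a , r , nf , d) , _ ← ih .run σ rs =
  expand A (gmap efq efqᶜ r) (reflect A (nefq nf) (⊥E d))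

fundamental-VFree : ∀ {m} {Γ : Ctx m} {t A} → VFree t → Γ ⊢ t ∶ A → Sem Γ t A
fundamental-VFree v           (ax i)     = varS i
fundamental-VFree v           (⇒I d)     = lamS (fundamental-VFree v d)
fundamental-VFree (v₁ , v₂)   (⇒E d e)   = appS (fundamental-VFree v₁ d) (fundamental-VFree v₂ e)
fundamental-VFree (v₁ , v₂)   (∧I d e)   = pairS (fundamental-VFree v₁ d) (fundamental-VFree v₂ e)
fundamental-VFree v           (∧E₁ d)    = fstS (fundamental-VFree v d)
fundamental-VFree v           (∧E₂ d)    = sndS (fundamental-VFree v d)
fundamental-VFree v           (∨I₁ d)    = inlS (fundamental-VFree v d)
fundamental-VFree v           (∨I₂ d)    = inrS (fundamental-VFree v d)
fundamental-VFree (v₁ , v₂ , v₃) (∨E d e f) =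
  caseS (fundamental-VFree v₁ d) (fundamental-VFree v₂ e) (fundamental-VFree v₃ f)
fundamental-VFree v           (⊥E d)     = efqS (fundamental-VFree v d)

-- A neutral term typed under
-- x⃗ : B⃗ → C⃗ is a bare variable, or contains in weak head position an efq
-- or an application of a variable: exactly the redexes of the V rules.

data Stuck {n} (Bs Cs : Vec Form n) : Tm n → Form → Set where
  head-var  : ∀ i → Stuck Bs Cs (var i) (lookup Bs i ⇒ lookup Cs i)
  stuck-efq : ∀ W {x T} → Nf x → zipWith _⇒_ Bs Cs ⊢ x ∶ ⊥' →
              Stuck Bs Cs (plug W (efq x)) T
  stuck-var : ∀ W j {x T} → Nf x → zipWith _⇒_ Bs Cs ⊢ x ∶ lookup Bs j →
              Stuck Bs Cs (plug W (app (var j) x)) T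

decompose : ∀ {n} {Bs Cs : Vec Form n} {t T} → Ne t → zipWith _⇒_ Bs Cs ⊢ t ∶ T → Stuck Bs Cs t T
decompose {Bs = Bs} {Cs} nvar (ax i) =
  subst (Stuck Bs Cs (var i)) (sym (lookup-zipWith _⇒_ i Bs Cs)) (head-var i)
decompose (napp nn nf) (⇒E d e) with decompose nn d
... | head-var i          = stuck-var hole i nf e
... | stuck-efq W nx dx   = stuck-efq (appW W _) nx dx
... | stuck-var W j nx dx = stuck-var (appW W _) j nx dx
decompose (nπ₁ nn) (∧E₁ d) with decompose nn d
... | stuck-efq W nx dx   = stuck-efq (π₁W W) nx dx
... | stuck-var W j nx dx = stuck-var (π₁W W) j nx dx
decompose (nπ₂ nn) (∧E₂ d) with decompose nn d
... | stuck-efq W nx dx   = stuck-efq (π₂W W) nx dx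
... | stuck-var W j nx dx = stuck-var (π₂W W) j nx dx
decompose (ncase nn _ _) (∨E d _ _) with decompose nn d
... | stuck-efq W nx dx   = stuck-efq (caseW W _ _) nx dx
... | stuck-var W j nx dx = stuck-var (caseW W _ _) j nx dx
decompose (nefq nf) (⊥E d) = stuck-efq hole nf d

module VisserCase {m} {Γ : Ctx m} {k} (Bs Cs : Vec Form (suc k)) {A₁ A₂ D : Form}
         {s₁ s₂ : Tm (suc m)} {us : Vector (Tm (suc m)) (suc k)}
         (ih₁ : Sem (arrows (zipWith _⇒_ Bs Cs) A₁ ∷ Γ) s₁ D)
         (ih₂ : Sem (arrows (zipWith _⇒_ Bs Cs) A₂ ∷ Γ) s₂ D)
         (ihu : ∀ j → Sem (arrows (zipWith _⇒_ Bs Cs) (lookup Bs j) ∷ Γ) (us j) D)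
         {n} {Δ : Ctx n} (σ : Sub m n) (rs : RedSub Γ σ Δ) where

  Θ : Ctx (suc k)
  Θ = zipWith _⇒_ Bs Cs

  Vσ : Tm (suc k + n) → Tm n
  Vσ w = V k w (sub (liftS σ) s₁) (sub (liftS σ) s₂) (λ j → sub (liftS σ) (us j))

  abstraction-Red : ∀ {E} (b : Tm (suc k)) → VFree b → Θ ⊢ b ∶ E →
                    Red (arrows Θ E) Δ (lams (suc k) (ren (wkBound n) b))
  abstraction-Red {E} b v d =
    resp (arrows Θ E) (fundamental-VFree vλ dλ .run var id-RedSub) (sub-id _)
    where
    vλ : VFree (lams (suc k) (ren (wkBound n) b))
    vλ = VFree-lams (suc k) (ren (wkBound n) b) (VFree-ren (wkBound n) b v)
    dλ : Δ ⊢ lams (suc k) (ren (wkBound n) b) ∶ arrows Θ E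
    dλ = lams-⊢ (suc k) Θ E (ren (wkBound n) b) (ren-⊢ v d (λ i → lookup-++ˡ Θ Δ i))

  fire : (w : Tm (suc k)) → Nf w → Θ ⊢ w ∶ A₁ ∨' A₂ → Red D Δ (Vσ (ren (wkBound n) w))
  fire (in₁ w) (nin₁ nf) (∨I₁ d) =
    expand D (V-in₁ ◅ ε) (instantiate ih₁ rs (abstraction-Red w (nf-VFree nf) d))
  fire (in₂ w) (nin₂ nf) (∨I₂ d) =
    expand D (V-in₂ ◅ ε) (instantiate ih₂ rs (abstraction-Red w (nf-VFree nf) d))
  fire w (ne nn) dw with decompose nn dw
  ... | stuck-efq W {x} nx dx =
    expand D (V-efq-at (renW (wkBound n) W) (ren-plug (wkBound n) W (efq x)) ◅ ε)
             (instantiate ih₁ rs (abstraction-Red (efq x) (nf-VFree nx) (⊥E dx)))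
  ... | stuck-var W j {x} nx dx =
    expand D (V-var-at (renW (wkBound n) W) j (ren-plug (wkBound n) W (app (var j) x)) ◅ ε)
             (instantiate (ihu j) rs (abstraction-Red x (nf-VFree nx) dx))

  reducible : (t₀ : Tm (suc k)) → Sem Θ t₀ (A₁ ∨' A₂) →
              Red D Δ (sub σ (V k (ren (wkBound m) t₀) s₁ s₂ us))
  reducible t₀ ih₀ with w , r , nf , dw ← WN-resp (proj₁ (ih₀ .run var id-RedSub)) (sub-id t₀) =
    expand D (gmap Vσ Vᶜ body⟶w) (fire w nf dw)
    where
    body⟶w : sub (liftSⁿ (suc k) σ) (ren (wkBound m) t₀) ⟶* ren (wkBound n) w
    body⟶w = ⟶*-transport (≈-sym (sub-bound-body (suc k) σ t₀))
                          (ren-⟶*-exact (wkBound n) r (nf-VFree nf))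
                          (VFree-ren (wkBound n) w (nf-VFree nf))

visserS : ∀ {m} {Γ : Ctx m} {k} (Bs Cs : Vec Form (suc k)) {A₁ A₂ D} {t₀ s₁ s₂ us} →
          Sem (zipWith _⇒_ Bs Cs) t₀ (A₁ ∨' A₂) →
          Sem (arrows (zipWith _⇒_ Bs Cs) A₁ ∷ Γ) s₁ D →
          Sem (arrows (zipWith _⇒_ Bs Cs) A₂ ∷ Γ) s₂ D →
          (∀ j → Sem (arrows (zipWith _⇒_ Bs Cs) (lookup Bs j) ∷ Γ) (us j) D) →
          Sem Γ (V k (ren (wkBound m) t₀) s₁ s₂ us) D
visserS Bs Cs {t₀ = t₀} ih₀ ih₁ ih₂ ihu .run σ rs =
  VisserCase.reducible Bs Cs ih₁ ih₂ ihu σ rs t₀ ih₀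

fundamental : ∀ {m} {Γ : Ctx m} {t A} → Γ ⊢ t ∶ A → Sem Γ t A
fundamental (ax i)     = varS i
fundamental (⇒I d)     = lamS (fundamental d)
fundamental (⇒E d e)   = appS (fundamental d) (fundamental e)
fundamental (∧I d e)   = pairS (fundamental d) (fundamental e)
fundamental (∧E₁ d)    = fstS (fundamental d)
fundamental (∧E₂ d)    = sndS (fundamental d)
fundamental (∨I₁ d)    = inlS (fundamental d)
fundamental (∨I₂ d)    = inrS (fundamental d)
fundamental (∨E d e f) = caseS (fundamental d) (fundamental e) (fundamental f)
fundamental (⊥E d)     = efqS (fundamental d)
fundamental (visser Bs Cs _ refl d₀ e₁ e₂ eu) =
  visserS Bs Cs (fundamental d₀) (fundamental e₁) (fundamental e₂) (λ j → fundamental (eu j))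

mainTheorem1 : ∀ {m : ℕ} {Γ : Ctx m} {t : Tm m} {A : Form} →
               Γ ⊢ t ∶ A → ∃[ t' ] (t ⟶* t' × Normal t')
mainTheorem1 {Γ = Γ} {t = t} d
  with w , r , nf , _ ← WN-resp (proj₁ (fundamental d .run var (id-RedSub {Γ = Γ}))) (sub-id t) =
  w , r , λ (_ , s) → nf-normal nf s
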